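{- Let $(T_0,D_0,T_1,D_1,\dots,T_n,\{b_n,c_n,a_0,b_0\})$ be a ring of bowties in a matroid $M$, where $T_i=\{a_i,b_i,c_i\}$ and $D_j=\{b_j,c_j,a_{j+1},b_{j+1}\}$. Then \[M\backslash c_0,c_1,\dots,c_n/a_1\cong M\backslash a_0,b_1,a_2,a_3,\dots,a_n/b_2.\]
   Context: For $n\ge2$, a ring of bowties $(T_0,D_0,\dots,T_n,\{b_n,c_n,a_0,b_0\})$ in $M$ consists of distinct elements $a_i,b_i,c_i$ ($0\le i\le n$) such that each $T_i=\{a_i,b_i,c_i\}$ is a triangle ($3$-element circuit), each $D_j=\{b_j,c_j,a_{j+1},b_{j+1}\}$ ($0\le j\le n-1$) is a cocircuit, and $\{b_n,c_n,a_0,b_0\}$ is a cocircuit. -}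

module Defs where

open import Data.Bool using (Bool; if_then_else_)
open import Data.Nat using (ℕ; suc; _<_; _≤ᵇ_)
open import Data.Fin using (Fin; toℕ; zero; inject₁; fromℕ)
open import Data.Fin.Subset using (Subset; ⊥; ⁅_⁆; _∈_; _∉_; _⊆_; _⊂_; ∁; _∪_; _∩_; ⋃; ∣_∣)
open import Data.List using (List; map; allFin)
open import Data.Product using (Σ; ∃; _×_; _,_; proj₁)
open import Function using (Injective)
open import Function.Bundles using (_↔_; _⇔_; Inverse)
open import Relation.Binary.PropositionalEquality using (_≡_; _≢_)
open import Relation.Nullary using (¬_)

record Matroid (m : ℕ) : Set₁ where
  field
    Indep    : Subset m → Set
    indep-⊥  : Indep ⊥
    indep-⊆  : ∀ {X Y} → X ⊆ Y → Indep Y → Indep X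
    augment  : ∀ {X Y} → Indep X → Indep Y → ∣ X ∣ < ∣ Y ∣ →
               ∃ λ e → e ∈ Y × e ∉ X × Indep (⁅ e ⁆ ∪ X)

IsCircuitFor : ∀ {m} → (Subset m → Set) → Subset m → Set
IsCircuitFor Ind C = ¬ Ind C × (∀ Y → Y ⊂ C → Ind Y)

IsBase : ∀ {m} → Matroid m → Subset m → Set
IsBase M B = Matroid.Indep M B × (∀ Y → B ⊂ Y → ¬ Matroid.Indep M Y)

DualIndep : ∀ {m} → Matroid m → Subset m → Set
DualIndep M X = ∃ λ B → IsBase M B × (X ∩ B ≡ ⊥)

Circuit : ∀ {m} → Matroid m → Subset m → Set
Circuit M = IsCircuitFor (Matroid.Indep M)

Cocircuit : ∀ {m} → Matroid m → Subset m → Set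
Cocircuit M = IsCircuitFor (DualIndep M)

IsBasisOf : ∀ {m} → Matroid m → Subset m → Subset m → Set
IsBasisOf M Y J = J ⊆ Y × Matroid.Indep M J ×
                  (∀ e → e ∈ Y → e ∉ J → ¬ Matroid.Indep M (⁅ e ⁆ ∪ J))

MinorGround : ∀ {m} → Subset m → Subset m → Subset m
MinorGround X Y = ∁ (X ∪ Y)

-- Independent sets of the minor M \ X / Y (Oxley 3.1.7):
-- Z ⊆ E - X - Y and Z ∪ J independent in M for a basis J of Y.
MinorIndep : ∀ {m} → Matroid m → Subset m → Subset m → Subset m → Set
MinorIndep M X Y Z = Z ⊆ MinorGround X Y ×
  ∃ λ J → IsBasisOf M Y J × Matroid.Indep M (Z ∪ J)

El : ∀ {m} → Subset m → Set
El {m} S = Σ (Fin m) (λ e → e ∈ S)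

MinorIso : ∀ {m} → Matroid m → Subset m → Subset m → Subset m → Subset m → Set
MinorIso M X Y X' Y' =
  Σ (El (MinorGround X Y) ↔ El (MinorGround X' Y')) λ φ →
    ∀ Z Z' → Z ⊆ MinorGround X Y → Z' ⊆ MinorGround X' Y' →
      (∀ (x : El (MinorGround X Y)) →
         (proj₁ x ∈ Z) ⇔ (proj₁ (Inverse.to φ x) ∈ Z')) →
      MinorIndep M X Y Z ⇔ MinorIndep M X' Y' Z'

imgWhere : ∀ {k m} → (Fin k → Bool) → (Fin k → Fin m) → Subset m
imgWhere {k} P f = ⋃ (map (λ i → if P i then ⁅ f i ⁆ else ⊥) (allFin k))

img : ∀ {k m} → (Fin k → Fin m) → Subset m
img {k} f = ⋃ (map (λ i → ⁅ f i ⁆) (allFin k))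

triple : ∀ {m} → Fin m → Fin m → Fin m → Subset m
triple x y z = ⁅ x ⁆ ∪ (⁅ y ⁆ ∪ ⁅ z ⁆)

quad : ∀ {m} → Fin m → Fin m → Fin m → Fin m → Subset m
quad w x y z = ⁅ w ⁆ ∪ (⁅ x ⁆ ∪ (⁅ y ⁆ ∪ ⁅ z ⁆))

record RingOfBowties {m : ℕ} (M : Matroid m) (n : ℕ)
                     (a b c : Fin (suc n) → Fin m) : Set where
  field
    inj-a : Injective _≡_ _≡_ a
    inj-b : Injective _≡_ _≡_ b
    inj-c : Injective _≡_ _≡_ c
    a≢b   : ∀ i j → a i ≢ b j
    a≢c   : ∀ i j → a i ≢ c j
    b≢c   : ∀ i j → b i ≢ c j
    triangle  : ∀ i → Circuit M (triple (a i) (b i) (c i))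
    cocircuit : ∀ (j : Fin n) →
      Cocircuit M (quad (b (inject₁ j)) (c (inject₁ j)) (a (Data.Fin.suc j)) (b (Data.Fin.suc j)))
    cocircuit-last : Cocircuit M (quad (b (fromℕ n)) (c (fromℕ n)) (a zero) (b zero))

atLeast2 : ∀ {k} → Fin k → Bool
atLeast2 i = 2 ≤ᵇ toℕ i

module Submission where

open import Defs
open import Data.Nat using (ℕ; suc; _≤_; _<_; _+_; s≤s; z≤n)
open import Data.Nat.Properties
  using (≤-trans; ≤-refl; ≤-reflexive; ≤-<-trans; ≤⇒≯; ≰⇒>; _≤?_; <-≤-connex; <-irrefl; ≤-pred; n≤1+n;
         m<n⇒m<1+n; m≤n+m; +-suc; +-identityʳ; ≤⇒≤ᵇ; ≤ᵇ⇒≤; suc-injective)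
open import Data.Fin using (Fin; zero; suc; fromℕ<; fromℕ; toℕ; inject₁; #_)
open import Data.Fin.Properties using (_≟_; ≤∧≢⇒<; toℕ<n; toℕ-injective; toℕ-fromℕ; toℕ-inject₁)
open import Data.Fin.Subset using (Subset; ⊥; ⋃; ⁅_⁆; _∪_; _∩_; _∈_; _∉_; _⊆_; _─_; _-_; ∣_∣; inside; outside)
open import Data.Fin.Subset.Properties
open import Data.Fin.Permutation using (Permutation; _⟨$⟩ʳ_; _⟨$⟩ˡ_; inverseˡ; inverseʳ; transpose; _∘ₚ_)
open import Data.Vec using (_∷_; here; there; tabulate; lookup)
open import Data.Vec.Properties using (lookup∘tabulate; lookup⇒[]=; []=⇒lookup)
open import Data.Vec.Properties.WithK using ([]=-irrelevant)
open import Data.List using (List; []; _∷_; allFin)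
import Data.List as List
import Data.List.Relation.Unary.Any as Any
open import Data.List.Membership.Propositional using () renaming (_∈_ to _∈ₗ_)
open import Data.List.Membership.Propositional.Properties using (∈-allFin)
open import Data.Bool using (Bool; true; false; T; if_then_else_)
open import Data.Unit using (tt)
import Data.Empty as Empty
open import Data.Empty using (⊥-elim)
open import Data.Product using (∃; _×_; _,_; proj₁; proj₂)
import Data.Product as Product
open import Data.Sum using (_⊎_; inj₁; inj₂; [_,_]′)
import Data.Sum as Sum
open import Function using (_∘_; id)
open import Function.Bundles using (_⇔_; mk⇔; Equivalence; _↔_; mk↔ₛ′; Inverse)
import Function.Properties.Equivalence as ⇔
open import Level using (0ℓ)
open import Relation.Nullary using (¬_; yes; no; contradiction)
open import Relation.Binary.PropositionalEquality using (_≡_; _≢_; refl; sym; trans; cong; subst; module ≡-Reasoning)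
import Relation.Binary.Reasoning.Setoid as SetoidReasoning

-- Write M ∖ X ⟋ κ for the minor with the single contracted element κ.  If {x, y, κ} is a triangle,
-- then x and y are parallel in M ⟋ κ, so the transposition (x y) is an isomorphism from M ∖ X ⟋ κ
-- to M ∖ X′ ⟋ κ, where X′ trades x for y.  If D is a cocircuit with D − {κ, y} ⊆ X, then κ and y
-- are in series in M ∖ X, so (κ y) is an isomorphism from M ∖ X ⟋ κ to M ∖ X ⟋ y.
-- Start from M ∖ {c₀, …, cₙ} ⟋ a₁: the triangle T₁ trades c₁ for b₁, the cocircuit D₀ moves the
-- contraction to b₀, and T₀ trades c₀ for a₀.  Then, for i = n, n − 1, …, 2, the cocircuit
-- {bᵢ, cᵢ, aᵢ₊₁, bᵢ₊₁} (indices mod n + 1) moves the contraction from bᵢ₊₁ to bᵢ, and Tᵢ trades cᵢ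
-- for aᵢ.  This ends at M ∖ {a₀, b₁, a₂, …, aₙ} ⟋ b₂, and the composite of the transpositions is the
-- required isomorphism.

private variable m : ℕ

x∈⁅x⁆∪p : ∀ (x : Fin m) {p} → x ∈ ⁅ x ⁆ ∪ p
x∈⁅x⁆∪p x = p⊆p∪q _ (x∈⁅x⁆ x)

x∈p⇒⁅x⁆⊆p : ∀ {x : Fin m} {p} → x ∈ p → ⁅ x ⁆ ⊆ p
x∈p⇒⁅x⁆⊆p {x = x} x∈p y∈⁅x⁆ = subst (_∈ _) (sym (x∈⁅y⁆⇒x≡y x y∈⁅x⁆)) x∈p

∪-monoʳ : ∀ (p : Subset m) {q r} → q ⊆ r → p ∪ q ⊆ p ∪ r
∪-monoʳ p q⊆r = x∈p∪q⁺ ∘ Sum.map₂ q⊆r ∘ x∈p∪q⁻ p _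

∪-lub : ∀ {p q r : Subset m} → p ⊆ r → q ⊆ r → p ∪ q ⊆ r
∪-lub p⊆r q⊆r = [ p⊆r , q⊆r ]′ ∘ x∈p∪q⁻ _ _

x∈p─q⇒x∉q : ∀ {x : Fin m} (p q : Subset m) → x ∈ p ─ q → x ∉ q
x∈p─q⇒x∉q (_ ∷ p) (inside  ∷ q) () here
x∈p─q⇒x∉q (_ ∷ p) (outside ∷ q) here ()
x∈p─q⇒x∉q (_ ∷ p) (_       ∷ q) (there x∈p─q) (there x∈q) = x∈p─q⇒x∉q p q x∈p─q x∈q

x∉p-x : ∀ (x : Fin m) (p : Subset m) → x ∉ p - x
x∉p-x x p x∈p-x = x∈p─q⇒x∉q p ⁅ x ⁆ x∈p-x (x∈⁅x⁆ x)

x∉p⇒∣⁅x⁆∪p∣≡1+∣p∣ : ∀ {x : Fin m} {p} → x ∉ p → ∣ ⁅ x ⁆ ∪ p ∣ ≡ suc ∣ p ∣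
x∉p⇒∣⁅x⁆∪p∣≡1+∣p∣ {x = zero}  {inside  ∷ p} x∉p = contradiction here x∉p
x∉p⇒∣⁅x⁆∪p∣≡1+∣p∣ {x = zero}  {outside ∷ p} x∉p = cong (suc ∘ ∣_∣) (∪-identityˡ p)
x∉p⇒∣⁅x⁆∪p∣≡1+∣p∣ {x = suc x} {inside  ∷ p} x∉p = cong suc (x∉p⇒∣⁅x⁆∪p∣≡1+∣p∣ (x∉p ∘ there))
x∉p⇒∣⁅x⁆∪p∣≡1+∣p∣ {x = suc x} {outside ∷ p} x∉p = x∉p⇒∣⁅x⁆∪p∣≡1+∣p∣ (x∉p ∘ there)

∣p∣≤1+∣p-x∣ : ∀ (x : Fin m) (p : Subset m) → ∣ p ∣ ≤ suc ∣ p - x ∣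
∣p∣≤1+∣p-x∣ x p = ≤-trans (p⊆q⇒∣p∣≤∣q∣ p⊆⁅x⁆∪[p-x]) (≤-reflexive (x∉p⇒∣⁅x⁆∪p∣≡1+∣p∣ (x∉p-x x p)))
  where
  p⊆⁅x⁆∪[p-x] : p ⊆ ⁅ x ⁆ ∪ (p - x)
  p⊆⁅x⁆∪[p-x] {e} e∈p with e ≟ x
  ... | yes refl = x∈⁅x⁆∪p x
  ... | no  e≢x  = q⊆p∪q _ _ (x∈p∧x≢y⇒x∈p-y e∈p e≢x)

p⊆q∧∣q∣≤∣p∣⇒q⊆p : ∀ {p q : Subset m} → p ⊆ q → ∣ q ∣ ≤ ∣ p ∣ → q ⊆ p
p⊆q∧∣q∣≤∣p∣⇒q⊆p {p = p} p⊆q ∣q∣≤∣p∣ {x} x∈q with x ∈? p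
... | yes x∈p = x∈p
... | no  x∉p = contradiction (p⊂q⇒∣p∣<∣q∣ (p⊆q , x , x∈q , x∉p)) (≤⇒≯ ∣q∣≤∣p∣)

Disjoint : Subset m → Subset m → Set
Disjoint p q = ∀ {x} → x ∈ p → x ∉ q

Disjoint⇒∩≡⊥ : ∀ {p q : Subset m} → Disjoint p q → p ∩ q ≡ ⊥
Disjoint⇒∩≡⊥ {p = p} {q} p#q =
  ⊆-antisym (λ x∈p∩q → let x∈p , x∈q = x∈p∩q⁻ p q x∈p∩q in contradiction x∈q (p#q x∈p)) ⊥⊆

triple⊆ : ∀ {x y z : Fin m} {p} → x ∈ p → y ∈ p → z ∈ p → triple x y z ⊆ p
triple⊆ x∈p y∈p z∈p = ∪-lub (x∈p⇒⁅x⁆⊆p x∈p) (∪-lub (x∈p⇒⁅x⁆⊆p y∈p) (x∈p⇒⁅x⁆⊆p z∈p))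

triple-comm₁₂ : ∀ (x y z : Fin m) → triple x y z ≡ triple y x z
triple-comm₁₂ x y z = begin
  ⁅ x ⁆ ∪ (⁅ y ⁆ ∪ ⁅ z ⁆)  ≡⟨ ∪-assoc ⁅ x ⁆ ⁅ y ⁆ ⁅ z ⁆ ⟨
  (⁅ x ⁆ ∪ ⁅ y ⁆) ∪ ⁅ z ⁆  ≡⟨ cong (_∪ ⁅ z ⁆) (∪-comm ⁅ x ⁆ ⁅ y ⁆) ⟩
  (⁅ y ⁆ ∪ ⁅ x ⁆) ∪ ⁅ z ⁆  ≡⟨ ∪-assoc ⁅ y ⁆ ⁅ x ⁆ ⁅ z ⁆ ⟩
  ⁅ y ⁆ ∪ (⁅ x ⁆ ∪ ⁅ z ⁆)  ∎
  where open ≡-Reasoning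

triple-comm₂₃ : ∀ (x y z : Fin m) → triple x y z ≡ triple x z y
triple-comm₂₃ x y z = cong (⁅ x ⁆ ∪_) (∪-comm ⁅ y ⁆ ⁅ z ⁆)

x∈quad⁻ : ∀ {e w x y z : Fin m} → e ∈ quad w x y z → e ≡ w ⊎ e ≡ x ⊎ e ≡ y ⊎ e ≡ z
x∈quad⁻ {w = w} {x} {y} {z} =
  Sum.map (x∈⁅y⁆⇒x≡y w) (Sum.map (x∈⁅y⁆⇒x≡y x) (Sum.map (x∈⁅y⁆⇒x≡y y) (x∈⁅y⁆⇒x≡y z) ∘ x∈p∪q⁻ _ _) ∘ x∈p∪q⁻ _ _)
  ∘ x∈p∪q⁻ _ _

module _ {A : Set} (f : A → Subset m) where

  x∈⋃map⁻ : ∀ (xs : List A) {x} → x ∈ ⋃ (List.map f xs) → ∃ λ i → x ∈ f i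
  x∈⋃map⁻ []       x∈⋃ = ⊥-elim (∉⊥ x∈⋃)
  x∈⋃map⁻ (i ∷ xs) x∈⋃ = [ (i ,_) , x∈⋃map⁻ xs ]′ (x∈p∪q⁻ (f i) _ x∈⋃)

  x∈⋃map⁺ : ∀ {xs : List A} {i x} → i ∈ₗ xs → x ∈ f i → x ∈ ⋃ (List.map f xs)
  x∈⋃map⁺ (Any.here refl) x∈fi = p⊆p∪q _ x∈fi
  x∈⋃map⁺ (Any.there i∈)  x∈fi = q⊆p∪q _ _ (x∈⋃map⁺ i∈ x∈fi)

x∈img⇔ : ∀ {k} (f : Fin k → Fin m) {x} → x ∈ img f ⇔ ∃ λ i → f i ≡ x
x∈img⇔ f = mk⇔
  (λ x∈ → let i , x∈fi = x∈⋃map⁻ _ (allFin _) x∈ in i , sym (x∈⁅y⁆⇒x≡y _ x∈fi))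
  (λ { (i , refl) → x∈⋃map⁺ _ (∈-allFin i) (x∈⁅x⁆ (f i)) })

x∈if⇔ : ∀ b {x : Fin m} {p} → x ∈ (if b then p else ⊥) ⇔ (T b × x ∈ p)
x∈if⇔ true  = mk⇔ (tt ,_) proj₂
x∈if⇔ false = mk⇔ (⊥-elim ∘ ∉⊥) (λ ())

x∈imgWhere⇔ : ∀ {k} (P : Fin k → Bool) (f : Fin k → Fin m) {x} →
              x ∈ imgWhere P f ⇔ ∃ λ i → f i ≡ x × T (P i)
x∈imgWhere⇔ P f = mk⇔
  (λ x∈ → let i , x∈ifᵢ = x∈⋃map⁻ _ (allFin _) x∈
              Pi , x∈fi = Equivalence.to (x∈if⇔ (P i)) x∈ifᵢ
          in  i , sym (x∈⁅y⁆⇒x≡y _ x∈fi) , Pi)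
  (λ { (i , refl , Pi) → x∈⋃map⁺ _ (∈-allFin i) (Equivalence.from (x∈if⇔ (P i)) (Pi , x∈⁅x⁆ (f i))) })

true⇔ : ∀ {A B : Set} → A → B → A ⇔ B
true⇔ a b = mk⇔ (λ _ → b) (λ _ → a)

false⇔ : ∀ {A B : Set} → ¬ A → ¬ B → A ⇔ B
false⇔ ¬a ¬b = mk⇔ (⊥-elim ∘ ¬a) (⊥-elim ∘ ¬b)

data Position {n} (x y : Fin n) : Fin n → Set where
  at-x      : Position x y x
  at-y      : Position x y y
  elsewhere : ∀ {e} → e ≢ x → e ≢ y → Position x y e

position : ∀ {n} (x y e : Fin n) → Position x y e
position x y e with e ≟ x | e ≟ y
... | yes refl | _        = at-x
... | no  _    | yes refl = at-y
... | no  e≢x  | no  e≢y  = elsewhere e≢x e≢y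

module _ {n} (x y : Fin n) where

  transpose-x : transpose x y ⟨$⟩ʳ x ≡ y
  transpose-x with x ≟ x
  ... | yes _   = refl
  ... | no  x≢x = contradiction refl x≢x

  transpose-y : transpose x y ⟨$⟩ʳ y ≡ x
  transpose-y with y ≟ x
  ... | yes refl = refl
  ... | no  _ with y ≟ y
  ...   | yes _   = refl
  ...   | no  y≢y = contradiction refl y≢y

  transpose-elsewhere : ∀ {e} → e ≢ x → e ≢ y → transpose x y ⟨$⟩ʳ e ≡ e
  transpose-elsewhere {e} e≢x e≢y with e ≟ x
  ... | yes e≡x = contradiction e≡x e≢x
  ... | no  _ with e ≟ y
  ...   | yes e≡y = contradiction e≡y e≢y
  ...   | no  _   = refl

preimage : (Fin m → Fin m) → Subset m → Subset m
preimage f p = tabulate (λ x → lookup p (f x))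

x∈preimage⇔ : ∀ (f : Fin m → Fin m) p {x} → x ∈ preimage f p ⇔ f x ∈ p
x∈preimage⇔ f p {x} = mk⇔
  (λ x∈ → lookup⇒[]= (f x) p (trans (sym (lookup∘tabulate _ x)) ([]=⇒lookup x∈)))
  (λ fx∈ → lookup⇒[]= x (preimage f p) (trans (lookup∘tabulate _ x) ([]=⇒lookup fx∈)))

x∈preimage-transpose⇔ : ∀ {x y : Fin m} {p q} → y ∈ p ⇔ x ∈ q → x ∈ p ⇔ y ∈ q →
  (∀ {e} → e ≢ x → e ≢ y → e ∈ p ⇔ e ∈ q) → ∀ {e} → e ∈ preimage (transpose x y ⟨$⟩ʳ_) p ⇔ e ∈ q
x∈preimage-transpose⇔ {x = x} {y} {p} {q} y∈p⇔x∈q x∈p⇔y∈q elsewhere⇔ {e} =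
  ⇔.trans (x∈preimage⇔ _ p) (moved (position x y e))
  where
  moved : ∀ {e} → Position x y e → transpose x y ⟨$⟩ʳ e ∈ p ⇔ e ∈ q
  moved at-x = subst (λ z → z ∈ p ⇔ x ∈ q) (sym (transpose-x x y)) y∈p⇔x∈q
  moved at-y = subst (λ z → z ∈ p ⇔ y ∈ q) (sym (transpose-y x y)) x∈p⇔y∈q
  moved {e} (elsewhere e≢x e≢y) =
    subst (λ z → z ∈ p ⇔ e ∈ q) (sym (transpose-elsewhere x y e≢x e≢y)) (elsewhere⇔ e≢x e≢y)

module MatroidProperties {m : ℕ} (M : Matroid m) where
  open Matroid M

  private variable I J K D : Subset m

  Indep-ext : ∀ {p q} → (∀ {e} → e ∈ p ⇔ e ∈ q) → Indep p ⇔ Indep q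
  Indep-ext p≐q = mk⇔ (indep-⊆ (Equivalence.from p≐q)) (indep-⊆ (Equivalence.to p≐q))

  minorIndep-⁅⁆ : ∀ {X Z y} → Indep ⁅ y ⁆ → Z ⊆ MinorGround X ⁅ y ⁆ → MinorIndep M X ⁅ y ⁆ Z ⇔ Indep (Z ∪ ⁅ y ⁆)
  minorIndep-⁅⁆ {X} {Z} {y} iy Z⊆ = mk⇔ to (λ iZ+y → Z⊆ , ⁅ y ⁆ , (id , iy , λ _ e∈y e∉y _ → e∉y e∈y) , iZ+y)
    where
    to : MinorIndep M X ⁅ y ⁆ Z → Indep (Z ∪ ⁅ y ⁆)
    to (_ , J , (J⊆y , _ , J-maximal) , iZ∪J) with y ∈? J
    ... | yes y∈J = indep-⊆ (∪-monoʳ Z (x∈p⇒⁅x⁆⊆p y∈J)) iZ∪J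
    ... | no  y∉J = ⊥-elim (J-maximal y (x∈⁅x⁆ y) y∉J (indep-⊆ (∪-lub (x∈p⇒⁅x⁆⊆p (x∈⁅x⁆ y)) J⊆y) iy))

  augment-repeatedly : Indep I → Indep K → ∃ λ J → I ⊆ J × J ⊆ I ∪ K × Indep J × ∣ K ∣ ≤ ∣ J ∣
  augment-repeatedly {I} {K} iI iK = go ∣ K ∣ iI (m≤n+m ∣ K ∣ ∣ I ∣)
    where
    go : ∀ {I} k → Indep I → ∣ K ∣ ≤ ∣ I ∣ + k → ∃ λ J → I ⊆ J × J ⊆ I ∪ K × Indep J × ∣ K ∣ ≤ ∣ J ∣
    go {I} 0 iI bound = I , id , p⊆p∪q K , iI , subst (∣ K ∣ ≤_) (+-identityʳ ∣ I ∣) bound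
    go {I} (suc k) iI bound with ∣ K ∣ ≤? ∣ I ∣
    ... | yes ∣K∣≤∣I∣ = I , id , p⊆p∪q K , iI , ∣K∣≤∣I∣
    ... | no  ∣K∣≰∣I∣ with augment iI iK (≰⇒> ∣K∣≰∣I∣)
    ...   | e , e∈K , e∉I , iI+e with go k iI+e bound′
      where
      bound′ : ∣ K ∣ ≤ ∣ ⁅ e ⁆ ∪ I ∣ + k
      bound′ rewrite x∉p⇒∣⁅x⁆∪p∣≡1+∣p∣ e∉I | sym (+-suc ∣ I ∣ k) = bound
    ...     | J , I+e⊆J , J⊆I+e∪K , iJ , ∣K∣≤∣J∣ = J , I+e⊆J ∘ q⊆p∪q _ _ , J⊆I∪K , iJ , ∣K∣≤∣J∣
      where
      J⊆I∪K : J ⊆ I ∪ K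
      J⊆I∪K x∈J with x∈p∪q⁻ (⁅ e ⁆ ∪ I) K (J⊆I+e∪K x∈J)
      ... | inj₂ x∈K = q⊆p∪q I K x∈K
      ... | inj₁ x∈I+e = ∪-lub (x∈p⇒⁅x⁆⊆p (q⊆p∪q I K e∈K)) (p⊆p∪q K) x∈I+e

  large-indep⇒base : ∀ {B} → IsBase M B → Indep J → ∣ B ∣ ≤ ∣ J ∣ → IsBase M J
  large-indep⇒base {B = B} (iB , B-maximal) iJ ∣B∣≤∣J∣ = iJ , λ Y J⊂Y iY →
    let e , e∈Y , e∉B , iB+e = augment iB iY (≤-<-trans ∣B∣≤∣J∣ (p⊂q⇒∣p∣<∣q∣ J⊂Y))
    in  B-maximal (⁅ e ⁆ ∪ B) (q⊆p∪q _ _ , e , x∈⁅x⁆∪p e , e∉B) iB+e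

  cocircuit-meets-large-indep : ∀ {B} → Cocircuit M D → IsBase M B → Indep J → ∣ B ∣ ≤ ∣ J ∣ → ¬ Disjoint D J
  cocircuit-meets-large-indep (D-codependent , _) isB iJ ∣B∣≤∣J∣ D#J =
    D-codependent (_ , large-indep⇒base isB iJ ∣B∣≤∣J∣ , Disjoint⇒∩≡⊥ D#J)

  base-meeting-cocircuit-only-in : ∀ {d} → Cocircuit M D → d ∈ D →
    ∃ λ B → IsBase M B × (∀ {e} → e ∈ B → e ∈ D → e ≡ d)
  base-meeting-cocircuit-only-in {D} {d} (_ , D-minimal) d∈D with D-minimal (D - d) (x∈p⇒p-x⊂p d∈D)
  ... | B , isB , [D-d]∩B≡⊥ = B , isB , B∩D⊆d
    where
    B∩D⊆d : ∀ {e} → e ∈ B → e ∈ D → e ≡ d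
    B∩D⊆d {e} e∈B e∈D with e ≟ d
    ... | yes e≡d = e≡d
    ... | no  e≢d = contradiction (subst (e ∈_) [D-d]∩B≡⊥ (x∈p∩q⁺ (x∈p∧x≢y⇒x∈p-y e∈D e≢d , e∈B))) ∉⊥

  -- A set of size ∣ B ∣ that avoids D would be a basis avoiding D; so the augmenting element is d.
  cocircuit-augment-near-base : ∀ {B d} → Cocircuit M D → IsBase M B → (∀ {e} → e ∈ B → e ∈ D → e ≡ d) →
    Indep J → Disjoint J D → ∣ B ∣ ≤ suc ∣ J ∣ → Indep (⁅ d ⁆ ∪ J)
  cocircuit-augment-near-base {D} {J} {B} {d} cD isB@(iB , _) B∩D⊆d iJ J#D ∣B∣≤1+∣J∣
    with <-≤-connex ∣ J ∣ ∣ B ∣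
  ... | inj₂ ∣B∣≤∣J∣ = ⊥-elim (cocircuit-meets-large-indep cD isB iJ ∣B∣≤∣J∣ (λ e∈D e∈J → J#D e∈J e∈D))
  ... | inj₁ ∣J∣<∣B∣ with augment iJ iB ∣J∣<∣B∣
  ...   | e , e∈B , e∉J , iJ+e with e ∈? D
  ...     | yes e∈D = subst (λ x → Indep (⁅ x ⁆ ∪ J)) (B∩D⊆d e∈B e∈D) iJ+e
  ...     | no  e∉D = ⊥-elim (cocircuit-meets-large-indep cD isB iJ+e
              (subst (∣ B ∣ ≤_) (sym (x∉p⇒∣⁅x⁆∪p∣≡1+∣p∣ e∉J)) ∣B∣≤1+∣J∣) D#J+e)
    where
    D#J+e : Disjoint D (⁅ e ⁆ ∪ J)
    D#J+e x∈D = [ (λ x∈e → e∉D (subst (_∈ D) (x∈⁅y⁆⇒x≡y e x∈e) x∈D)) , (λ x∈J → J#D x∈J x∈D) ]′ ∘ x∈p∪q⁻ ⁅ e ⁆ J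

  -- E − D is a hyperplane, so no element of D is spanned by a subset of E − D.
  cocircuit-augment : ∀ {d} → Cocircuit M D → Indep I → Disjoint I D → d ∈ D → Indep (⁅ d ⁆ ∪ I)
  cocircuit-augment {D} {I} {d} cD iI I#D d∈D with base-meeting-cocircuit-only-in cD d∈D
  ... | B , isB , B∩D⊆d with augment-repeatedly iI (indep-⊆ (p─q⊆p B ⁅ d ⁆) (proj₁ isB))
  ...   | J , I⊆J , J⊆I∪[B-d] , iJ , ∣B-d∣≤∣J∣ =
    indep-⊆ (∪-monoʳ ⁅ d ⁆ I⊆J)
      (cocircuit-augment-near-base cD isB B∩D⊆d iJ J#D (≤-trans (∣p∣≤1+∣p-x∣ d B) (s≤s ∣B-d∣≤∣J∣)))
    where
    J#D : Disjoint J D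
    J#D x∈J x∈D with x∈p∪q⁻ I (B - d) (J⊆I∪[B-d] x∈J)
    ... | inj₁ x∈I   = I#D x∈I x∈D
    ... | inj₂ x∈B-d = x∉p-x d B (subst (_∈ B - d) (B∩D⊆d (p─q⊆p B ⁅ d ⁆ x∈B-d) x∈D) x∈B-d)

  cocircuit-exchange : ∀ {R x y} → Cocircuit M D → x ∈ D → y ∈ D → Disjoint R D →
                       Indep (⁅ x ⁆ ∪ R) ⇔ Indep (⁅ y ⁆ ∪ R)
  cocircuit-exchange cD x∈D y∈D R#D = mk⇔
    (λ iR+x → cocircuit-augment cD (indep-⊆ (q⊆p∪q _ _) iR+x) R#D y∈D)
    (λ iR+y → cocircuit-augment cD (indep-⊆ (q⊆p∪q _ _) iR+y) R#D x∈D)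

  triple-pair-indep : ∀ {x y z} → Circuit M (triple x y z) → y ≢ x → y ≢ z → Indep (⁅ x ⁆ ∪ ⁅ z ⁆)
  triple-pair-indep {x} {y} {z} (_ , T-minimal) y≢x y≢z = T-minimal _
    ( ∪-lub (p⊆p∪q _) (q⊆p∪q _ _ ∘ q⊆p∪q _ _)
    , y , q⊆p∪q _ _ (x∈⁅x⁆∪p y) , [ y≢x ∘ x∈⁅y⁆⇒x≡y x , y≢z ∘ x∈⁅y⁆⇒x≡y z ]′ ∘ x∈p∪q⁻ _ _ )

  -- Grow {x, z} inside {x, z} ∪ (y + R); the result cannot contain y, so it is x + R.
  triangle-exchange : ∀ {R x y z} → Circuit M (triple x y z) → y ≢ x → y ≢ z →
                      x ∉ R → y ∉ R → z ∈ R → Indep (⁅ y ⁆ ∪ R) → Indep (⁅ x ⁆ ∪ R)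
  triangle-exchange {R} {x} {y} {z} T@(T-dependent , _) y≢x y≢z x∉R y∉R z∈R iR+y
    with augment-repeatedly (triple-pair-indep T y≢x y≢z) iR+y
  ... | J , xz⊆J , J⊆xz∪[R+y] , iJ , ∣R+y∣≤∣J∣ = indep-⊆ (p⊆q∧∣q∣≤∣p∣⇒q⊆p J⊆R+x ∣R+x∣≤∣J∣) iJ
    where
    y∉J : y ∉ J
    y∉J y∈J = T-dependent (indep-⊆ (triple⊆ (xz⊆J (x∈⁅x⁆∪p x)) y∈J (xz⊆J (q⊆p∪q _ _ (x∈⁅x⁆ z)))) iJ)
    J⊆R+x : J ⊆ ⁅ x ⁆ ∪ R
    J⊆R+x {e} e∈J with x∈p∪q⁻ _ _ (J⊆xz∪[R+y] e∈J)
    ... | inj₁ e∈xz = ∪-monoʳ ⁅ x ⁆ (x∈p⇒⁅x⁆⊆p z∈R) e∈xz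
    ... | inj₂ e∈R+y with x∈p∪q⁻ ⁅ y ⁆ R e∈R+y
    ...   | inj₁ e∈y = ⊥-elim (y∉J (subst (_∈ J) (x∈⁅y⁆⇒x≡y y e∈y) e∈J))
    ...   | inj₂ e∈R = q⊆p∪q _ _ e∈R
    ∣R+x∣≤∣J∣ : ∣ ⁅ x ⁆ ∪ R ∣ ≤ ∣ J ∣
    ∣R+x∣≤∣J∣ rewrite x∉p⇒∣⁅x⁆∪p∣≡1+∣p∣ x∉R | sym (x∉p⇒∣⁅x⁆∪p∣≡1+∣p∣ y∉R) = ∣R+y∣≤∣J∣

  triangle-exchange⇔ : ∀ {R x y z} → Circuit M (triple x y z) → x ≢ y → x ≢ z → y ≢ z →
                       x ∉ R → y ∉ R → z ∈ R → Indep (⁅ x ⁆ ∪ R) ⇔ Indep (⁅ y ⁆ ∪ R)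
  triangle-exchange⇔ {x = x} {y} {z} T x≢y x≢z y≢z x∉R y∉R z∈R = mk⇔
    (triangle-exchange (subst (Circuit M) (triple-comm₁₂ x y z) T) x≢y x≢z y∉R x∉R z∈R)
    (triangle-exchange T (x≢y ∘ sym) y≢z x∉R y∉R z∈R)

  module _ {x y : Fin m} (S : Subset m) (x≢y : x ≢ y) where

    private
      R : Subset m
      R = S ─ (⁅ x ⁆ ∪ ⁅ y ⁆)

      x∉R : x ∉ R
      x∉R x∈R = x∈p─q⇒x∉q S _ x∈R (x∈⁅x⁆∪p x)

      y∉R : y ∉ R
      y∉R y∈R = x∈p─q⇒x∉q S _ y∈R (q⊆p∪q _ _ (x∈⁅x⁆ y))

      ∈R : ∀ {e} → e ∈ S → e ≢ x → e ≢ y → e ∈ R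
      ∈R e∈S e≢x e≢y = x∈p∧x∉q⇒x∈p─q e∈S ([ e≢x ∘ x∈⁅y⁆⇒x≡y x , e≢y ∘ x∈⁅y⁆⇒x≡y y ]′ ∘ x∈p∪q⁻ _ _)

      ∉⁅z⁆∪R : ∀ {z w} → w ≢ z → w ∉ R → w ∉ ⁅ z ⁆ ∪ R
      ∉⁅z⁆∪R {z} w≢z w∉R = [ w≢z ∘ x∈⁅y⁆⇒x≡y z , w∉R ]′ ∘ x∈p∪q⁻ _ _

      S≐⁅z⁆∪R : ∀ {z} → z ∈ S → (∀ {e} → e ∈ S → e ≢ z → e ≢ x × e ≢ y) → ∀ {e} → e ∈ S ⇔ e ∈ ⁅ z ⁆ ∪ R
      S≐⁅z⁆∪R {z} z∈S S∩xy⊆z {e} = mk⇔ to (∪-lub (x∈p⇒⁅x⁆⊆p z∈S) (p─q⊆p S _))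
        where
        to : e ∈ S → e ∈ ⁅ z ⁆ ∪ R
        to e∈S with e ≟ z
        ... | yes refl = x∈⁅x⁆∪p e
        ... | no  e≢z  = let e≢x , e≢y = S∩xy⊆z e∈S e≢z in q⊆p∪q _ _ (∈R e∈S e≢x e≢y)

      elsewhere-∈⁅z⁆∪R⇔ : ∀ {z e} → e ≢ z → e ≢ x → e ≢ y → e ∈ S ⇔ e ∈ ⁅ z ⁆ ∪ R
      elsewhere-∈⁅z⁆∪R⇔ {z} e≢z e≢x e≢y = mk⇔ (λ e∈S → q⊆p∪q _ _ (∈R e∈S e≢x e≢y))
        ([ ⊥-elim ∘ e≢z ∘ x∈⁅y⁆⇒x≡y z , p─q⊆p S _ ]′ ∘ x∈p∪q⁻ _ _)

      transpose-indep-by-cases : Indep (⁅ x ⁆ ∪ R) ⇔ Indep (⁅ y ⁆ ∪ R) →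
                                 Indep (preimage (transpose x y ⟨$⟩ʳ_) S) ⇔ Indep S
      transpose-indep-by-cases R+x⇔R+y with x ∈? S | y ∈? S
      ... | yes x∈S | yes y∈S = Indep-ext (x∈preimage-transpose⇔ (true⇔ y∈S x∈S) (true⇔ x∈S y∈S) (λ _ _ → ⇔.refl))
      ... | no  x∉S | no  y∉S = Indep-ext (x∈preimage-transpose⇔ (false⇔ y∉S x∉S) (false⇔ x∉S y∉S) (λ _ _ → ⇔.refl))
      ... | yes x∈S | no  y∉S = begin
        Indep (preimage (transpose x y ⟨$⟩ʳ_) S)
          ≈⟨ Indep-ext (x∈preimage-transpose⇔ (false⇔ y∉S (∉⁅z⁆∪R x≢y x∉R)) (true⇔ x∈S (x∈⁅x⁆∪p y))
                          (λ e≢x e≢y → elsewhere-∈⁅z⁆∪R⇔ e≢y e≢x e≢y)) ⟩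
        Indep (⁅ y ⁆ ∪ R)  ≈⟨ R+x⇔R+y ⟨
        Indep (⁅ x ⁆ ∪ R)  ≈⟨ Indep-ext (S≐⁅z⁆∪R x∈S λ e∈S e≢x → e≢x , λ { refl → y∉S e∈S }) ⟨
        Indep S            ∎
        where open SetoidReasoning (⇔.⇔-setoid 0ℓ)
      ... | no  x∉S | yes y∈S = begin
        Indep (preimage (transpose x y ⟨$⟩ʳ_) S)
          ≈⟨ Indep-ext (x∈preimage-transpose⇔ (true⇔ y∈S (x∈⁅x⁆∪p x)) (false⇔ x∉S (∉⁅z⁆∪R (x≢y ∘ sym) y∉R))
                          (λ e≢x e≢y → elsewhere-∈⁅z⁆∪R⇔ e≢x e≢x e≢y)) ⟩
        Indep (⁅ x ⁆ ∪ R)  ≈⟨ R+x⇔R+y ⟩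
        Indep (⁅ y ⁆ ∪ R)  ≈⟨ Indep-ext (S≐⁅z⁆∪R y∈S λ e∈S e≢y → (λ { refl → x∉S e∈S }) , e≢y) ⟨
        Indep S            ∎
        where open SetoidReasoning (⇔.⇔-setoid 0ℓ)

    -- In the hypothesis, R stands for S with x and y removed.
    transpose-indep : (∀ {R} → R ⊆ S → x ∉ R → y ∉ R → (∀ {e} → e ∈ S → e ≢ x → e ≢ y → e ∈ R) →
                         Indep (⁅ x ⁆ ∪ R) ⇔ Indep (⁅ y ⁆ ∪ R)) →
                      Indep (preimage (transpose x y ⟨$⟩ʳ_) S) ⇔ Indep S
    transpose-indep exchange = transpose-indep-by-cases (exchange (p─q⊆p S _) x∉R y∉R ∈R)

module SingleContraction {m} (M : Matroid m) where
  open Matroid M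
  open MatroidProperties M

  -- deleted ⟋ contracted stands for M ∖ deleted ⟋ contracted; deletions are given by a predicate.
  record Minor : Set₁ where
    constructor _⟋_
    field
      deleted    : Fin m → Set
      contracted : Fin m
  open Minor

  Avoids : Subset m → (Fin m → Set) → Set
  Avoids S P = ∀ {e} → e ∈ S → ¬ P e

  -- When κ is not a loop, the independent sets of M ∖ X ⟋ κ are the I − κ for the independent sets I
  -- of M with κ ∈ I and I ∩ X = ∅,
  -- so π-indep says that π is an isomorphism of the two minors.
  record _≅_ (N N′ : Minor) : Set where
    field
      π            : Permutation m m
      π-deleted    : ∀ e → deleted N e ⇔ deleted N′ (π ⟨$⟩ʳ e)
      π-contracted : π ⟨$⟩ʳ contracted N ≡ contracted N′
      π-indep      : ∀ S → contracted N′ ∈ S → Avoids S (deleted N′) →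
                     Indep (preimage (π ⟨$⟩ʳ_) S) ⇔ Indep S

  ≅-trans : ∀ {N₁ N₂ N₃} → N₁ ≅ N₂ → N₂ ≅ N₃ → N₁ ≅ N₃
  ≅-trans N₁≅N₂ N₂≅N₃ = record
    { π            = F.π ∘ₚ G.π
    ; π-deleted    = λ e → ⇔.trans (F.π-deleted e) (G.π-deleted (F.π ⟨$⟩ʳ e))
    ; π-contracted = trans (cong (G.π ⟨$⟩ʳ_) F.π-contracted) G.π-contracted
    ; π-indep      = λ S κ∈S S-avoids → begin
        Indep (preimage ((F.π ∘ₚ G.π) ⟨$⟩ʳ_) S)
          ≈⟨ Indep-ext (⇔.trans (x∈preimage⇔ _ S) (⇔.sym (⇔.trans (x∈preimage⇔ _ _) (x∈preimage⇔ _ S)))) ⟩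
        Indep (preimage (F.π ⟨$⟩ʳ_) (preimage (G.π ⟨$⟩ʳ_) S))
          ≈⟨ F.π-indep _ (Equivalence.from (x∈preimage⇔ _ S) (subst (_∈ S) (sym G.π-contracted) κ∈S))
                         (λ e∈ → S-avoids (Equivalence.to (x∈preimage⇔ _ S) e∈) ∘ Equivalence.to (G.π-deleted _)) ⟩
        Indep (preimage (G.π ⟨$⟩ʳ_) S)
          ≈⟨ G.π-indep S κ∈S S-avoids ⟩
        Indep S ∎
    }
    where
    module F = _≅_ N₁≅N₂
    module G = _≅_ N₂≅N₃
    open SetoidReasoning (⇔.⇔-setoid 0ℓ)

  triangle-≅ : ∀ {x y κ Del Del′} → Circuit M (triple x y κ) → x ≢ y → x ≢ κ → y ≢ κ →
               (∀ e → Del e ⇔ Del′ (transpose x y ⟨$⟩ʳ e)) → (Del ⟋ κ) ≅ (Del′ ⟋ κ)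
  triangle-≅ {x} {y} {κ} T x≢y x≢κ y≢κ Del⇔Del′ = record
    { π            = transpose x y
    ; π-deleted    = Del⇔Del′
    ; π-contracted = transpose-elsewhere x y (x≢κ ∘ sym) (y≢κ ∘ sym)
    ; π-indep      = λ S κ∈S _ → transpose-indep S x≢y λ _ x∉R y∉R S∖xy⊆R →
        triangle-exchange⇔ T x≢y x≢κ y≢κ x∉R y∉R (S∖xy⊆R κ∈S (x≢κ ∘ sym) (y≢κ ∘ sym))
    }

  cocircuit-≅ : ∀ {D κ y Del} → Cocircuit M D → κ ∈ D → y ∈ D → κ ≢ y →
                (∀ {e} → e ∈ D → e ≢ κ → e ≢ y → Del e) → ¬ Del κ → ¬ Del y → (Del ⟋ κ) ≅ (Del ⟋ y)
  cocircuit-≅ {D} {κ} {y} {Del} cD κ∈D y∈D κ≢y D∖κy⊆Del ¬Del-κ ¬Del-y = record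
    { π            = transpose κ y
    ; π-deleted    = λ e → Del-transpose (position κ y e)
    ; π-contracted = transpose-x κ y
    ; π-indep      = λ S _ S-avoids → transpose-indep S κ≢y λ R⊆S κ∉R y∉R _ →
        cocircuit-exchange cD κ∈D y∈D λ e∈R e∈D → S-avoids (R⊆S e∈R)
          (D∖κy⊆Del e∈D (λ { refl → κ∉R e∈R }) (λ { refl → y∉R e∈R }))
    }
    where
    Del-transpose : ∀ {e} → Position κ y e → Del e ⇔ Del (transpose κ y ⟨$⟩ʳ e)
    Del-transpose at-x = false⇔ ¬Del-κ (subst (¬_ ∘ Del) (sym (transpose-x κ y)) ¬Del-y)
    Del-transpose at-y = false⇔ ¬Del-y (subst (¬_ ∘ Del) (sym (transpose-y κ y)) ¬Del-κ)
    Del-transpose {e} (elsewhere e≢κ e≢y) = subst (λ z → Del e ⇔ Del z) (sym (transpose-elsewhere κ y e≢κ e≢y)) ⇔.refl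

  ≅⇒MinorIso : ∀ {Del Del′ κ κ′ X X′} → (Del ⟋ κ) ≅ (Del′ ⟋ κ′) →
    (∀ e → Del e ⇔ e ∈ X) → (∀ e → Del′ e ⇔ e ∈ X′) → κ ∉ X → Indep ⁅ κ ⁆ → Indep ⁅ κ′ ⁆ →
    MinorIso M X ⁅ κ ⁆ X′ ⁅ κ′ ⁆
  ≅⇒MinorIso {Del} {Del′} {κ} {κ′} {X} {X′} N≅N′ Del≐X Del′≐X′ κ∉X iκ iκ′ = φ , indep-correspondence
    where
    open _≅_ N≅N′
    open Equivalence using (to; from)

    π-injective : ∀ {e f} → π ⟨$⟩ʳ e ≡ π ⟨$⟩ʳ f → e ≡ f
    π-injective πe≡πf = trans (sym (inverseˡ π)) (trans (cong (π ⟨$⟩ˡ_) πe≡πf) (inverseˡ π))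

    e∈κ⇔πe∈κ′ : ∀ {e} → e ∈ ⁅ κ ⁆ ⇔ π ⟨$⟩ʳ e ∈ ⁅ κ′ ⁆
    e∈κ⇔πe∈κ′ = mk⇔
      (λ e∈κ → subst (λ z → π ⟨$⟩ʳ z ∈ ⁅ κ′ ⁆) (sym (x∈⁅y⁆⇒x≡y κ e∈κ))
                 (subst (_∈ ⁅ κ′ ⁆) (sym π-contracted) (x∈⁅x⁆ κ′)))
      (λ πe∈κ′ → subst (_∈ ⁅ κ ⁆) (sym (π-injective (trans (x∈⁅y⁆⇒x≡y κ′ πe∈κ′) (sym π-contracted)))) (x∈⁅x⁆ κ))

    e∈X⇔πe∈X′ : ∀ {e} → e ∈ X ⇔ π ⟨$⟩ʳ e ∈ X′
    e∈X⇔πe∈X′ = ⇔.trans (⇔.sym (Del≐X _)) (⇔.trans (π-deleted _) (Del′≐X′ _))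

    ground-preserve : ∀ {e} → e ∈ MinorGround X ⁅ κ ⁆ → π ⟨$⟩ʳ e ∈ MinorGround X′ ⁅ κ′ ⁆
    ground-preserve e∈ = x∉p⇒x∈∁p
      ([ x∈∁p⇒x∉p e∈ ∘ p⊆p∪q _ ∘ from e∈X⇔πe∈X′ , x∈∁p⇒x∉p e∈ ∘ q⊆p∪q _ _ ∘ from e∈κ⇔πe∈κ′ ]′ ∘ x∈p∪q⁻ X′ _)

    ground-reflect : ∀ {e} → π ⟨$⟩ʳ e ∈ MinorGround X′ ⁅ κ′ ⁆ → e ∈ MinorGround X ⁅ κ ⁆
    ground-reflect πe∈ = x∉p⇒x∈∁p
      ([ x∈∁p⇒x∉p πe∈ ∘ p⊆p∪q _ ∘ to e∈X⇔πe∈X′ , x∈∁p⇒x∉p πe∈ ∘ q⊆p∪q _ _ ∘ to e∈κ⇔πe∈κ′ ]′ ∘ x∈p∪q⁻ X _)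

    El-≡ : ∀ {S : Subset m} {u v} {u∈S : u ∈ S} {v∈S : v ∈ S} → u ≡ v → _≡_ {A = El S} (u , u∈S) (v , v∈S)
    El-≡ refl = cong (_ ,_) ([]=-irrelevant _ _)

    φ : El (MinorGround X ⁅ κ ⁆) ↔ El (MinorGround X′ ⁅ κ′ ⁆)
    φ = mk↔ₛ′ (λ (e , e∈) → π ⟨$⟩ʳ e , ground-preserve e∈)
              (λ (e , e∈) → π ⟨$⟩ˡ e , ground-reflect (subst (_∈ _) (sym (inverseʳ π)) e∈))
              (λ _ → El-≡ (inverseʳ π)) (λ _ → El-≡ (inverseˡ π))

    indep-correspondence : ∀ Z Z′ → Z ⊆ MinorGround X ⁅ κ ⁆ → Z′ ⊆ MinorGround X′ ⁅ κ′ ⁆ →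
      (∀ (x : El (MinorGround X ⁅ κ ⁆)) → (proj₁ x ∈ Z) ⇔ (proj₁ (Inverse.to φ x) ∈ Z′)) →
      MinorIndep M X ⁅ κ ⁆ Z ⇔ MinorIndep M X′ ⁅ κ′ ⁆ Z′
    indep-correspondence Z Z′ Z⊆ Z′⊆ Z⇔Z′ = begin
      MinorIndep M X ⁅ κ ⁆ Z                    ≈⟨ minorIndep-⁅⁆ iκ Z⊆ ⟩
      Indep (Z ∪ ⁅ κ ⁆)                         ≈⟨ Indep-ext Z∪κ≐ ⟩
      Indep (preimage (π ⟨$⟩ʳ_) (Z′ ∪ ⁅ κ′ ⁆))  ≈⟨ π-indep _ (q⊆p∪q _ _ (x∈⁅x⁆ κ′)) Z′∪κ′-avoids ⟩
      Indep (Z′ ∪ ⁅ κ′ ⁆)                       ≈⟨ minorIndep-⁅⁆ iκ′ Z′⊆ ⟨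
      MinorIndep M X′ ⁅ κ′ ⁆ Z′                 ∎
      where
      open SetoidReasoning (⇔.⇔-setoid 0ℓ)
      Z∪κ≐ : ∀ {e} → e ∈ Z ∪ ⁅ κ ⁆ ⇔ e ∈ preimage (π ⟨$⟩ʳ_) (Z′ ∪ ⁅ κ′ ⁆)
      Z∪κ≐ {e} = ⇔.trans (mk⇔ to′ from′) (⇔.sym (x∈preimage⇔ _ _))
        where
        to′ : e ∈ Z ∪ ⁅ κ ⁆ → π ⟨$⟩ʳ e ∈ Z′ ∪ ⁅ κ′ ⁆
        to′ = [ p⊆p∪q _ ∘ (λ e∈Z → to (Z⇔Z′ (e , Z⊆ e∈Z)) e∈Z) , q⊆p∪q _ _ ∘ to e∈κ⇔πe∈κ′ ]′ ∘ x∈p∪q⁻ Z _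
        from′ : π ⟨$⟩ʳ e ∈ Z′ ∪ ⁅ κ′ ⁆ → e ∈ Z ∪ ⁅ κ ⁆
        from′ = [ p⊆p∪q _ ∘ (λ πe∈Z′ → from (Z⇔Z′ (e , ground-reflect (Z′⊆ πe∈Z′))) πe∈Z′)
                , q⊆p∪q _ _ ∘ from e∈κ⇔πe∈κ′ ]′ ∘ x∈p∪q⁻ Z′ _
      Z′∪κ′-avoids : Avoids (Z′ ∪ ⁅ κ′ ⁆) Del′
      Z′∪κ′-avoids e∈ Del′-e with x∈p∪q⁻ Z′ _ e∈
      ... | inj₁ e∈Z′ = x∈∁p⇒x∉p (Z′⊆ e∈Z′) (p⊆p∪q _ (to (Del′≐X′ _) Del′-e))
      ... | inj₂ e∈κ′ = κ∉X (to (Del≐X κ) (from (π-deleted κ)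
                          (subst Del′ (trans (x∈⁅y⁆⇒x≡y κ′ e∈κ′) (sym π-contracted)) Del′-e)))

data Label : Set where
  A B C : Label

module RingOfBowtiesProperties {m k : ℕ} (M : Matroid m) (a b c : Fin (3 + k) → Fin m)
                               (ring : RingOfBowties M (2 + k) a b c) where
  open Matroid M
  open RingOfBowties ring
  open MatroidProperties M
  open SingleContraction M

  Index : Set
  Index = Label × Fin (3 + k)

  element : Index → Fin m
  element (A , i) = a i
  element (B , i) = b i
  element (C , i) = c i

  element-injective : ∀ {r s} → element r ≡ element s → r ≡ s
  element-injective {A , i} {A , j} eq = cong (A ,_) (inj-a eq)
  element-injective {A , i} {B , j} eq = ⊥-elim (a≢b i j eq)
  element-injective {A , i} {C , j} eq = ⊥-elim (a≢c i j eq)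
  element-injective {B , i} {A , j} eq = ⊥-elim (a≢b j i (sym eq))
  element-injective {B , i} {B , j} eq = cong (B ,_) (inj-b eq)
  element-injective {B , i} {C , j} eq = ⊥-elim (b≢c i j eq)
  element-injective {C , i} {A , j} eq = ⊥-elim (a≢c j i (sym eq))
  element-injective {C , i} {B , j} eq = ⊥-elim (b≢c j i (sym eq))
  element-injective {C , i} {C , j} eq = cong (C ,_) (inj-c eq)

  -- Every deletion set below consists of ring elements, described by their labels.
  Labelled : (Index → Set) → Fin m → Set
  Labelled P e = ∃ λ r → element r ≡ e × P r

  Labelled-element : ∀ {P} r → Labelled P (element r) ⇔ P r
  Labelled-element {P} _ = mk⇔ (λ (s , eq , Ps) → subst P (element-injective eq) Ps) (λ Pr → _ , refl , Pr)

  Labelled-transpose : ∀ {P P′ p q} → P p ⇔ P′ q → P q ⇔ P′ p → (∀ r → r ≢ p → r ≢ q → P r ⇔ P′ r) →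
                       ∀ e → Labelled P e ⇔ Labelled P′ (transpose (element p) (element q) ⟨$⟩ʳ e)
  Labelled-transpose {P} {P′} {p} {q} Pp⇔P′q Pq⇔P′p unmoved e = moved (position (element p) (element q) e)
    where
    τ : Fin m → Fin m
    τ = transpose (element p) (element q) ⟨$⟩ʳ_
    unmoved′ : ∀ r → element r ≢ element p → element r ≢ element q → P r ⇔ P′ r
    unmoved′ r r≢p r≢q = unmoved r (r≢p ∘ cong element) (r≢q ∘ cong element)
    moved : ∀ {e} → Position (element p) (element q) e → Labelled P e ⇔ Labelled P′ (τ e)
    moved at-x = subst (λ z → Labelled P (element p) ⇔ Labelled P′ z) (sym (transpose-x (element p) (element q)))
                   (⇔.trans (Labelled-element p) (⇔.trans Pp⇔P′q (⇔.sym (Labelled-element q))))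
    moved at-y = subst (λ z → Labelled P (element q) ⇔ Labelled P′ z) (sym (transpose-y (element p) (element q)))
                   (⇔.trans (Labelled-element q) (⇔.trans Pq⇔P′p (⇔.sym (Labelled-element p))))
    moved {e} (elsewhere e≢p e≢q) =
      subst (λ z → Labelled P e ⇔ Labelled P′ z) (sym (transpose-elsewhere (element p) (element q) e≢p e≢q))
        (mk⇔ (λ { (r , refl , Pr)  → r , refl , Equivalence.to   (unmoved′ r e≢p e≢q) Pr })
             (λ { (r , refl , P′r) → r , refl , Equivalence.from (unmoved′ r e≢p e≢q) P′r }))

  triangle-cab : ∀ i → Circuit M (triple (c i) (a i) (b i))
  triangle-cab i = subst (Circuit M)
    (trans (triple-comm₂₃ (a i) (b i) (c i)) (triple-comm₁₂ (a i) (c i) (b i))) (triangle i)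

  triangle-cba : ∀ i → Circuit M (triple (c i) (b i) (a i))
  triangle-cba i = subst (Circuit M) (triple-comm₂₃ (c i) (a i) (b i)) (triangle-cab i)

  InC : Index → Set
  InC (L , _) = L ≡ C

  Stage₁ : Index → Set
  Stage₁ (A , _) = Empty.⊥
  Stage₁ (B , i) = i ≡ # 1
  Stage₁ (C , i) = i ≢ # 1

  -- The deletion set once the descent has reached index t; t = n + 1 before it starts.
  Deleted : ℕ → Index → Set
  Deleted t (A , i) = i ≡ zero ⊎ t ≤ toℕ i
  Deleted t (B , i) = i ≡ # 1
  Deleted t (C , i) = 2 ≤ toℕ i × toℕ i < t

  2≤toℕ : ∀ {i : Fin (3 + k)} → i ≢ zero → i ≢ # 1 → 2 ≤ toℕ i
  2≤toℕ {zero}        i≢0 _   = contradiction refl i≢0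
  2≤toℕ {suc zero}    _   i≢1 = contradiction refl i≢1
  2≤toℕ {suc (suc i)} _   _   = s≤s (s≤s z≤n)

  trade-c₁-for-b₁ : (Labelled InC ⟋ a (# 1)) ≅ (Labelled Stage₁ ⟋ a (# 1))
  trade-c₁-for-b₁ = triangle-≅ (triangle-cba (# 1)) (b≢c _ _ ∘ sym) (a≢c _ _ ∘ sym) (a≢b _ _ ∘ sym)
    (Labelled-transpose {p = C , # 1} {q = B , # 1} (true⇔ refl refl) (false⇔ (λ ()) (λ 1≢1 → 1≢1 refl)) unmoved)
    where
    unmoved : ∀ r → r ≢ (C , # 1) → r ≢ (B , # 1) → InC r ⇔ Stage₁ r
    unmoved (A , i) _    _    = false⇔ (λ ()) (λ ())
    unmoved (B , i) _    r≢B₁ = false⇔ (λ ()) (λ { refl → r≢B₁ refl })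
    unmoved (C , i) r≢C₁ _    = true⇔ refl (λ { refl → r≢C₁ refl })

  contract-b₀ : (Labelled Stage₁ ⟋ a (# 1)) ≅ (Labelled Stage₁ ⟋ b zero)
  contract-b₀ = cocircuit-≅ (cocircuit zero) (q⊆p∪q _ _ (q⊆p∪q _ _ (x∈⁅x⁆∪p _))) (x∈⁅x⁆∪p _) (a≢b _ _) D₀-rest
    ((λ ()) ∘ Equivalence.to (Labelled-element (A , # 1))) ((λ ()) ∘ Equivalence.to (Labelled-element (B , zero)))
    where
    D₀-rest : ∀ {e} → e ∈ quad (b zero) (c zero) (a (# 1)) (b (# 1)) → e ≢ a (# 1) → e ≢ b zero → Labelled Stage₁ e
    D₀-rest e∈D₀ e≢a₁ e≢b₀ with x∈quad⁻ e∈D₀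
    ... | inj₁ refl               = contradiction refl e≢b₀
    ... | inj₂ (inj₁ refl)        = (C , zero) , refl , λ ()
    ... | inj₂ (inj₂ (inj₁ refl)) = contradiction refl e≢a₁
    ... | inj₂ (inj₂ (inj₂ refl)) = (B , # 1) , refl , refl

  trade-c₀-for-a₀ : (Labelled Stage₁ ⟋ b zero) ≅ (Labelled (Deleted (3 + k)) ⟋ b zero)
  trade-c₀-for-a₀ = triangle-≅ (triangle-cab zero) (a≢c _ _ ∘ sym) (b≢c _ _ ∘ sym) (a≢b _ _)
    (Labelled-transpose {p = C , zero} {q = A , zero} (true⇔ (λ ()) (inj₁ refl)) (false⇔ (λ ()) (λ ())) unmoved)
    where
    unmoved : ∀ r → r ≢ (C , zero) → r ≢ (A , zero) → Stage₁ r ⇔ Deleted (3 + k) r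
    unmoved (A , i) _    r≢A₀ = false⇔ (λ ()) [ (λ { refl → r≢A₀ refl }) , (λ 3+k≤i → ≤⇒≯ 3+k≤i (toℕ<n i)) ]′
    unmoved (B , i) _    _    = ⇔.refl
    unmoved (C , i) r≢C₀ _    = mk⇔ (λ i≢1 → 2≤toℕ (λ { refl → r≢C₀ refl }) i≢1 , toℕ<n i) (λ { (s≤s () , _) refl })

  -- i′ is the successor of i in the ring: i + 1, or 0 when i = n.
  descend-step : ∀ {t} i i′ → t ≡ suc (toℕ i) → 2 ≤ toℕ i → i′ ≡ zero ⊎ t ≤ toℕ i′ →
                 Cocircuit M (quad (b i) (c i) (a i′) (b i′)) →
                 (Labelled (Deleted t) ⟋ b i′) ≅ (Labelled (Deleted (toℕ i)) ⟋ b i)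
  descend-step i i′ refl 2≤i i′-next Dᵢ = ≅-trans
    (cocircuit-≅ Dᵢ (q⊆p∪q _ _ (q⊆p∪q _ _ (q⊆p∪q _ _ (x∈⁅x⁆ _)))) (x∈⁅x⁆∪p _) (i′≢i ∘ inj-b) Dᵢ-rest
      (i′≢1 ∘ Equivalence.to (Labelled-element (B , i′))) (i≢1 ∘ Equivalence.to (Labelled-element (B , i))))
    (triangle-≅ (triangle-cab i) (a≢c _ _ ∘ sym) (b≢c _ _ ∘ sym) (a≢b _ _)
      (Labelled-transpose {p = C , i} {q = A , i} (true⇔ (2≤i , ≤-refl) (inj₂ ≤-refl))
        (false⇔ [ i≢0 , <-irrefl refl ]′ (<-irrefl refl ∘ proj₂)) unmoved))
    where
    i≢0 : i ≢ zero
    i≢0 refl = contradiction 2≤i λ ()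
    i≢1 : i ≢ # 1
    i≢1 refl = contradiction 2≤i λ { (s≤s ()) }
    i′≢1 : i′ ≢ # 1
    i′≢1 refl = [ (λ ()) , (λ 1+i≤1 → contradiction (≤-trans 2≤i (≤-pred 1+i≤1)) λ ()) ]′ i′-next
    i′≢i : i′ ≢ i
    i′≢i refl = [ i≢0 , <-irrefl refl ]′ i′-next
    Dᵢ-rest : ∀ {e} → e ∈ quad (b i) (c i) (a i′) (b i′) → e ≢ b i′ → e ≢ b i → Labelled (Deleted (suc (toℕ i))) e
    Dᵢ-rest e∈Dᵢ e≢bᵢ′ e≢bᵢ with x∈quad⁻ e∈Dᵢ
    ... | inj₁ refl               = contradiction refl e≢bᵢ
    ... | inj₂ (inj₁ refl)        = (C , i) , refl , 2≤i , ≤-refl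
    ... | inj₂ (inj₂ (inj₁ refl)) = (A , i′) , refl , i′-next
    ... | inj₂ (inj₂ (inj₂ refl)) = contradiction refl e≢bᵢ′
    unmoved : ∀ r → r ≢ (C , i) → r ≢ (A , i) → Deleted (suc (toℕ i)) r ⇔ Deleted (toℕ i) r
    unmoved (A , j) _    r≢Aᵢ = mk⇔ (Sum.map₂ (≤-trans (n≤1+n _)))
                                    (Sum.map₂ (λ i≤j → ≤∧≢⇒< i≤j (λ { refl → r≢Aᵢ refl })))
    unmoved (B , j) _    _    = ⇔.refl
    unmoved (C , j) r≢Cᵢ _    = mk⇔ (Product.map₂ (λ j<1+i → ≤∧≢⇒< (≤-pred j<1+i) (λ { refl → r≢Cᵢ refl })))
                                    (Product.map₂ m<n⇒m<1+n)

  Reaches : Fin (3 + k) → Set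
  Reaches i = (Labelled InC ⟋ a (# 1)) ≅ (Labelled (Deleted (toℕ i)) ⟋ b i)

  reaches-last : Reaches (fromℕ (2 + k))
  reaches-last = ≅-trans trade-c₁-for-b₁ (≅-trans contract-b₀ (≅-trans trade-c₀-for-a₀
    (descend-step (fromℕ (2 + k)) zero (cong suc (sym (toℕ-fromℕ (2 + k)))) (s≤s (s≤s z≤n)) (inj₁ refl)
                  cocircuit-last)))

  reaches-down : ∀ d i → toℕ i ≡ 2 + d → Reaches i → Reaches (# 2)
  reaches-down 0       i       toℕi≡2   reaches-i = subst Reaches (toℕ-injective toℕi≡2) reaches-i
  reaches-down (suc d) (suc j) toℕi≡3+d reaches-i = reaches-down d (inject₁ j) toℕj≡2+d (≅-trans reaches-i
    (descend-step (inject₁ j) (suc j) (cong suc (sym (toℕ-inject₁ j))) (subst (2 ≤_) (sym toℕj≡2+d) (s≤s (s≤s z≤n)))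
                  (inj₂ ≤-refl) (cocircuit j)))
    where
    toℕj≡2+d : toℕ (inject₁ j) ≡ 2 + d
    toℕj≡2+d = trans (toℕ-inject₁ j) (suc-injective toℕi≡3+d)

  InC≐img-c : ∀ e → Labelled InC e ⇔ e ∈ img c
  InC≐img-c e = ⇔.trans (mk⇔ (λ { ((C , i) , cᵢ≡e , _) → i , cᵢ≡e }) (λ (i , cᵢ≡e) → (C , i) , cᵢ≡e , refl))
                        (⇔.sym (x∈img⇔ c))

  Deleted₂≐ : ∀ e → Labelled (Deleted 2) e ⇔ e ∈ ⁅ a zero ⁆ ∪ (⁅ b (# 1) ⁆ ∪ imgWhere atLeast2 a)
  Deleted₂≐ e = mk⇔ to from
    where
    to : Labelled (Deleted 2) e → e ∈ ⁅ a zero ⁆ ∪ (⁅ b (# 1) ⁆ ∪ imgWhere atLeast2 a)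
    to ((A , i) , refl , inj₁ refl) = x∈⁅x⁆∪p _
    to ((A , i) , refl , inj₂ 2≤i)  =
      q⊆p∪q _ _ (q⊆p∪q _ _ (Equivalence.from (x∈imgWhere⇔ atLeast2 a) (i , refl , ≤⇒≤ᵇ 2≤i)))
    to ((B , i) , refl , refl)      = q⊆p∪q _ _ (x∈⁅x⁆∪p _)
    to ((C , i) , refl , 2≤i , i<2) = contradiction i<2 (≤⇒≯ 2≤i)
    from : e ∈ ⁅ a zero ⁆ ∪ (⁅ b (# 1) ⁆ ∪ imgWhere atLeast2 a) → Labelled (Deleted 2) e
    from e∈ with x∈p∪q⁻ _ _ e∈
    ... | inj₁ e∈a₀ = (A , zero) , sym (x∈⁅y⁆⇒x≡y _ e∈a₀) , inj₁ refl
    ... | inj₂ e∈ with x∈p∪q⁻ _ _ e∈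
    ...   | inj₁ e∈b₁ = (B , # 1) , sym (x∈⁅y⁆⇒x≡y _ e∈b₁) , refl
    ...   | inj₂ e∈aᵢ = let i , aᵢ≡e , 2≤ᵇi = Equivalence.to (x∈imgWhere⇔ atLeast2 a) e∈aᵢ
                        in  (A , i) , aᵢ≡e , inj₂ (≤ᵇ⇒≤ 2 (toℕ i) 2≤ᵇi)

  ring-minors-iso : MinorIso M (img c) ⁅ a (# 1) ⁆ (⁅ a zero ⁆ ∪ (⁅ b (# 1) ⁆ ∪ imgWhere atLeast2 a)) ⁅ b (# 2) ⁆
  ring-minors-iso = ≅⇒MinorIso (reaches-down k (fromℕ (2 + k)) (toℕ-fromℕ (2 + k)) reaches-last)
    InC≐img-c Deleted₂≐ (λ a₁∈img-c → let i , cᵢ≡a₁ = Equivalence.to (x∈img⇔ c) a₁∈img-c in a≢c _ _ (sym cᵢ≡a₁))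
    (indep-⊆ (q⊆p∪q _ _) (triple-pair-indep (triangle-cba (# 1)) (b≢c _ _) (a≢b _ _ ∘ sym)))
    (indep-⊆ (q⊆p∪q _ _) (triple-pair-indep (triangle-cab (# 2)) (a≢c _ _) (a≢b _ _)))

lemma10p2 : ∀ {m : ℕ} (M : Matroid m) (n : ℕ) (n≥2 : 2 ≤ n)
    (a b c : Fin (suc n) → Fin m) →
    RingOfBowties M n a b c →
    MinorIso M
      (img c) ⁅ a (fromℕ< (s≤s (≤-trans (s≤s z≤n) n≥2))) ⁆
      (⁅ a zero ⁆ ∪ (⁅ b (fromℕ< (s≤s (≤-trans (s≤s z≤n) n≥2))) ⁆ ∪ imgWhere atLeast2 a))
      ⁅ b (fromℕ< (s≤s n≥2)) ⁆
lemma10p2 M (suc (suc k)) (s≤s (s≤s z≤n)) a b c ring = RingOfBowtiesProperties.ring-minors-iso M a b c ring
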